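{- Run the following algorithm: set $T=\max_{e\in E}r_e+\lambda\max_{e\in E}(D_e\Delta(e))$; for $t=1,\dots,T$: let $O'$ be the subgraph of the current $O$ induced by the vertices $e$ with $t>r_e$ and set $c(v)=u(v)$ for all $v\in V$; while $O'$ is nonempty: choose a kernel $U$ of $O'$, schedule every $e\in U$ in time slot $t$ and decrease $c(v)$ by one for every node $v$ of every $e\in U$, remove $U$ from $O$ and from $O'$, and for every node $v$ with $c(v)=0$ remove from $O'$ all hyperedges containing $v$. Then the algorithm produces a feasible edge schedule on $G$ — every hyperedge $e$ is scheduled in exactly one slot $t>r_e$, and in every slot each node $v$ is contained in at most $u(v)$ scheduled hyperedges — in which every hyperedge $e$ is scheduled not later than $r_e+\lambda D_e\Delta(e)$.
   Context: Let $G=(V,E)$ be a hypergraph (repeated hyperedges treated as distinct) with $|e|\le\lambda$ for all $e\in E$, node capacities $u(v)\in\mathbb{Z}_{>0}$, and for each hyperedge $e$ a release time $r_e\in\mathbb{Z}_{\ge0}$ and a deadline $D_e$. Define $\mathrm{avg}(e)=\frac{1}{|e|}\sum_{v\in e}u(v)$ and $\Delta(e)=\left\lceil\frac{\mathrm{avg}(e)}{\min_{v\in e}u(v)}\right\rceil$. The line graph $L(G)$ has vertex set $E$ and an edge between distinct hyperedges iff they share a node. Index the hyperedges $e_1,\dots,e_N$ so that $D_{e_1}\le\dots\le D_{e_N}$, and let $O$ be the orientation of $L(G)$ orienting each edge $\{e_i,e_j\}$ with $i>j$ as $(e_i,e_j)$. Assume $|d^+(e)|\le\lambda(D_e\cdot\mathrm{avg}(e)-1)$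 for all $e$, where $d^+(e)$ is the set of arcs of $O$ leaving $e$. A kernel of a digraph is an independent set $U$ such that every vertex not in $U$ has an arc to some vertex of $U$; removing vertices also removes their incident arcs. -}

module Defs where

open import Data.Nat using (ℕ; zero; suc; _+_; _*_; _∸_; _≤_; _<_; _<?_; _⊔_; _⊓_)
open import Data.Nat.DivMod using (_/_)
open import Data.Bool using (Bool; true; false; _∧_; if_then_else_)
open import Data.Maybe using (Maybe; just; nothing; maybe; fromMaybe)
open import Data.List using (List; []; _∷_)
open import Data.List.Membership.DecPropositional (Data.Nat._≟_) using () renaming (_∈?_ to _∈ℕ?_)
open import Data.Fin using (Fin; zero; suc; toℕ)
open import Data.Fin.Subset using (Subset; _∈_; _∉_; _⊆_; _∩_; _─_; ∣_∣; Nonempty; Empty; ⊤)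
open import Data.Fin.Subset.Properties using (_∈?_)
open import Relation.Binary.PropositionalEquality using (_≡_)
open import Data.Vec using (Vec; []; _∷_; tabulate)
open import Data.Product using (Σ; ∃; ∃-syntax; _×_; _,_)
open import Function using (_∘_)
open import Relation.Nullary using (¬_; does)
open import Relation.Nullary.Decidable using (_×-dec_)
open import Data.Fin.Properties using (any?)

sumOver : ∀ {n} → Subset n → (Fin n → ℕ) → ℕ
sumOver [] f = 0
sumOver (true ∷ S) f = f zero + sumOver S (f ∘ suc)
sumOver (false ∷ S) f = sumOver S (f ∘ suc)

minOver : ∀ {n} → Subset n → (Fin n → ℕ) → Maybe ℕ
minOver [] f = nothing
minOver (true ∷ S) f = just (maybe (f zero ⊓_) (f zero) (minOver S (f ∘ suc)))
minOver (false ∷ S) f = minOver S (f ∘ suc)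

maxAll : ∀ {N} → (Fin N → ℕ) → ℕ
maxAll {zero} f = 0
maxAll {suc N} f = f zero ⊔ maxAll (f ∘ suc)

-- ceiling division ⌈ a / b ⌉ (convention: 0 when b = 0; never used then)
ceilDiv : ℕ → ℕ → ℕ
ceilDiv a zero = 0
ceilDiv a (suc b) = (a + b) / suc b

-- Problem instance: nodes Fin n, hyperedges e_1..e_N as Fin N (the index
-- order is the order sorted by deadline), node capacities, release times,
-- deadlines, and the bound λ on hyperedge size.

record Instance : Set where
  field
    n N    : ℕ
    edge   : Fin N → Subset n
    cap    : Fin n → ℕ
    rel    : Fin N → ℕ
    dl     : Fin N → ℕ
    lam    : ℕ

-- A schedule records, for each hyperedge, the list of slots in which it
-- was scheduled (so "scheduled exactly once" is a genuine condition).
Schedule : ℕ → Set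
Schedule N = Fin N → List ℕ

module _ (I : Instance) where
  open Instance I

  sumCap : Fin N → ℕ
  sumCap i = sumOver (edge i) cap

  minCap : Fin N → ℕ
  minCap i = fromMaybe 0 (minOver (edge i) cap)

  -- Δ(e) = ⌈ avg(e) / min u ⌉ = ⌈ sumCap e / (|e| · min u) ⌉
  Δ : Fin N → ℕ
  Δ i = ceilDiv (sumCap i) (∣ edge i ∣ * minCap i)

  Share : Fin N → Fin N → Set
  Share i j = ∃[ v ] (v ∈ edge i × v ∈ edge j)

  -- arc (e_i , e_j) of the orientation O of L(G): i > j and they share a node
  Arc : Fin N → Fin N → Set
  Arc i j = toℕ j < toℕ i × Share i j

  outNbrs : Fin N → Subset N
  outNbrs i = tabulate (λ j → does ((toℕ j <? toℕ i) ×-dec any? (λ v → (v ∈? edge i) ×-dec (v ∈? edge j))))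

  horizon : ℕ
  horizon = maxAll rel + lam * maxAll (λ i → dl i * Δ i)

  released : ℕ → Subset N
  released t = tabulate (λ i → does (rel i <? t))

  incident : Fin n → Subset N
  incident v = tabulate (λ i → does (v ∈? edge i))

  IsKernel : Subset N → Subset N → Set
  IsKernel S U =
    U ⊆ S
    × (∀ i j → i ∈ U → j ∈ U → ¬ Arc i j)
    × (∀ i → i ∈ S → i ∉ U → ∃[ j ] (j ∈ U × Arc i j))

  scheduleAt : ℕ → Subset N → Schedule N → Schedule N
  scheduleAt t U σ i = if does (i ∈? U) then t ∷ σ i else σ i

  -- The inner while-loop of slot t, as a (nondeterministic) big-step relation.
  -- Inner t R O' c σ R* σ* : starting with remaining hyperedges R (the current
  -- O), current O', residual capacities c and schedule σ, the loop can
  -- terminate with remaining hyperedges R* and schedule σ*.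
  data Inner (t : ℕ) : Subset N → Subset N → (Fin n → ℕ) → Schedule N
                     → Subset N → Schedule N → Set where
    done : ∀ {R O' c σ} → Empty O' → Inner t R O' c σ R σ
    step : ∀ {R O' c σ R* σ*} (U O'' : Subset N) →
           Nonempty O' →
           IsKernel O' U →
           (∀ i → i ∈ O'' → i ∈ O' × i ∉ U
                  × (∀ v → v ∈ edge i → ¬ (c v ∸ ∣ U ∩ incident v ∣ ≡ 0))) →
           (∀ i → i ∈ O' → i ∉ U
                  → (∀ v → v ∈ edge i → ¬ (c v ∸ ∣ U ∩ incident v ∣ ≡ 0))
                  → i ∈ O'') →
           Inner t (R ─ U) O'' (λ v → c v ∸ ∣ U ∩ incident v ∣) (scheduleAt t U σ) R* σ* →
           Inner t R O' c σ R* σ*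

  data Slots : ℕ → ℕ → Subset N → Schedule N → Schedule N → Set where
    stop : ∀ {t R σ} → Slots t 0 R σ σ
    next : ∀ {t k R σ R' σ' σ*} →
           Inner t R (R ∩ released t) cap σ R' σ' →
           Slots (suc t) k R' σ' σ* →
           Slots t (suc k) R σ σ*

  AlgOutput : Schedule N → Set
  AlgOutput σ = Slots 1 horizon ⊤ (λ _ → []) σ

  load : Schedule N → ℕ → Fin n → ℕ
  load σ t v = ∣ tabulate (λ i → does (v ∈? edge i) ∧ does (t ∈ℕ? σ i)) ∣

  Feasible : Schedule N → Set
  Feasible σ =
    (∀ i → ∃[ t ] (σ i ≡ t ∷ [] × rel i < t))
    × (∀ t v → load σ t v ≤ cap v)

  WithinBound : Schedule N → Set
  WithinBound σ = ∀ i → ∃[ t ] (σ i ≡ t ∷ [] × t ≤ rel i + lam * dl i * Δ i)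

  Hyps : Set
  Hyps =
    (∀ v → 0 < cap v)
    × (∀ i → Nonempty (edge i))
    × (∀ i → ∣ edge i ∣ ≤ lam)
    × (∀ i j → toℕ i ≤ toℕ j → dl i ≤ dl j)
    -- |d⁺(e)| ≤ λ (D_e · avg(e) − 1), multiplied through by |e| > 0:
    × (∀ i → ∣ edge i ∣ * ∣ outNbrs i ∣ + lam * ∣ edge i ∣ ≤ lam * (dl i * sumCap i))

-- Arcs of O point from later to earlier hyperedges, so every induced subgraph has a kernel (add the
-- hyperedges in index order unless already absorbed); each round therefore schedules something and the
-- inner loop terminates. A kernel contains at most one hyperedge through each node, and the loop stops
-- using a node once its capacity is spent, so capacities are respected. If a released e stays pending
-- through slot t, some node v of e was saturated, and in each of the rounds that consumed v's capacity
-- the kernel absorbed e, i.e. scheduled an out-neighbour of e; so e loses at least min u out-neighbours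
-- per such slot. Since |d⁺(e)| < λ D_e avg(e) ≤ λ D_e Δ(e) min u, e waits fewer than λ D_e Δ(e) released
-- slots, hence is scheduled by r_e + λ D_e Δ(e) ≤ T.

module Submission where

open import Defs
open import Data.Bool using (if_then_else_)
open import Data.Fin using (Fin; zero; suc; toℕ)
import Data.Fin as Fin
open import Data.Fin.Properties using (any?; all?; toℕ-injective; toℕ<n)
open import Data.Fin.Subset
open import Data.Fin.Subset.Properties
open import Data.List using ([]; _∷_)
open import Data.List.Membership.Propositional using () renaming (_∈_ to _∈ₗ_)
open import Data.List.Relation.Unary.Any using (toSum)
open import Data.Maybe using (just; nothing)
open import Data.Nat using (ℕ; zero; suc; _+_; _*_; _∸_; _≤_; _<_; z≤n; s≤s; s≤s⁻¹; z<s; _≟_; _<?_)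
open import Data.List.Membership.DecPropositional _≟_ using () renaming (_∈?_ to _∈ₗ?_)
open import Data.Nat.DivMod using (_/_; _%_; m≡m%n+[m/n]*n; m%n<n)
open import Data.Nat.Properties
open import Data.Product using (∃; ∃-syntax; _×_; _,_; proj₁; proj₂)
open import Data.Sum using (_⊎_; inj₁; inj₂; map₁)
open import Data.Vec using ([]; _∷_; here; there; tabulate)
open import Data.Vec.Properties using ([]=⇒lookup; lookup⇒[]=; lookup∘tabulate)
open import Function using (_∘_)
open import Relation.Binary.PropositionalEquality
open import Relation.Binary using (tri<; tri≈; tri>)
open import Relation.Nullary using (¬_; Dec; yes; no; does; proof; contradiction)
open import Relation.Nullary.Decidable using (dec-true; dec-false; _×-dec_; _→-dec_; ¬?)
open import Relation.Nullary.Reflects using (Reflects; invert)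
open import Relation.Unary using (Pred; Decidable)
open import Data.Nat.Solver using (module +-*-Solver)
open +-*-Solver using (solve; _:*_; _:+_; _:=_; con)

∈-comprehension⁺ : ∀ {n ℓ} {P : Pred (Fin n) ℓ} (P? : Decidable P) {i} → P i → i ∈ tabulate (does ∘ P?)
∈-comprehension⁺ P? {i} p = lookup⇒[]= i _ (trans (lookup∘tabulate _ i) (dec-true (P? i) p))

∈-comprehension⁻ : ∀ {n ℓ} {P : Pred (Fin n) ℓ} (P? : Decidable P) {i} → i ∈ tabulate (does ∘ P?) → P i
∈-comprehension⁻ {P = P} P? {i} i∈ =
  invert (subst (Reflects (P i)) (trans (sym (lookup∘tabulate _ i)) ([]=⇒lookup i∈)) (proof (P? i)))

x∈p─q⇒x∉q : ∀ {n} (p q : Subset n) {x} → x ∈ p ─ q → x ∉ q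
x∈p─q⇒x∉q (_ ∷ p) (outside ∷ q) here        = λ ()
x∈p─q⇒x∉q (_ ∷ p) (_ ∷ q)       (there x∈) (there x∈q) = x∈p─q⇒x∉q p q x∈ x∈q

∣p∣≡∣p─q∣+∣p∩q∣ : ∀ {n} (p q : Subset n) → ∣ p ∣ ≡ ∣ p ─ q ∣ + ∣ p ∩ q ∣
∣p∣≡∣p─q∣+∣p∩q∣ []            []            = refl
∣p∣≡∣p─q∣+∣p∩q∣ (outside ∷ p) (outside ∷ q) = ∣p∣≡∣p─q∣+∣p∩q∣ p q
∣p∣≡∣p─q∣+∣p∩q∣ (outside ∷ p) (inside ∷ q)  = ∣p∣≡∣p─q∣+∣p∩q∣ p q
∣p∣≡∣p─q∣+∣p∩q∣ (inside ∷ p)  (outside ∷ q) = cong suc (∣p∣≡∣p─q∣+∣p∩q∣ p q)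
∣p∣≡∣p─q∣+∣p∩q∣ (inside ∷ p)  (inside ∷ q)  = trans (cong suc (∣p∣≡∣p─q∣+∣p∩q∣ p q)) (sym (+-suc _ _))

p─r⊆q⇒∣p∣≤∣q∣+∣r∣ : ∀ {n} {p q : Subset n} r → p ─ r ⊆ q → ∣ p ∣ ≤ ∣ q ∣ + ∣ r ∣
p─r⊆q⇒∣p∣≤∣q∣+∣r∣ {p = p} {q} r p─r⊆q = begin
  ∣ p ∣                 ≡⟨ ∣p∣≡∣p─q∣+∣p∩q∣ p r ⟩
  ∣ p ─ r ∣ + ∣ p ∩ r ∣ ≤⟨ +-mono-≤ (p⊆q⇒∣p∣≤∣q∣ p─r⊆q) (∣p∩q∣≤∣q∣ p r) ⟩
  ∣ q ∣ + ∣ r ∣         ∎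
  where open ≤-Reasoning

∣p∩[q─r]∣+∣p∩r∣≤∣p∩q∣ : ∀ {n} (p q r : Subset n) → r ⊆ q → ∣ p ∩ (q ─ r) ∣ + ∣ p ∩ r ∣ ≤ ∣ p ∩ q ∣
∣p∩[q─r]∣+∣p∩r∣≤∣p∩q∣ p q r r⊆q = begin
  ∣ p ∩ (q ─ r) ∣ + ∣ p ∩ r ∣       ≤⟨ +-mono-≤ (p⊆q⇒∣p∣≤∣q∣ ⊆-left) (p⊆q⇒∣p∣≤∣q∣ ⊆-right) ⟩
  ∣ p ∩ q ─ r ∣ + ∣ (p ∩ q) ∩ r ∣ ≡⟨ ∣p∣≡∣p─q∣+∣p∩q∣ (p ∩ q) r ⟨
  ∣ p ∩ q ∣                         ∎
  where
  open ≤-Reasoning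
  ⊆-left : p ∩ (q ─ r) ⊆ p ∩ q ─ r
  ⊆-left x∈ with x∈p∩q⁻ p _ x∈
  ... | x∈p , x∈q─r = x∈p∧x∉q⇒x∈p─q (x∈p∩q⁺ (x∈p , p─q⊆p q r x∈q─r)) (x∈p─q⇒x∉q q r x∈q─r)
  ⊆-right : p ∩ r ⊆ (p ∩ q) ∩ r
  ⊆-right x∈ with x∈p∩q⁻ p r x∈
  ... | x∈p , x∈r = x∈p∩q⁺ (x∈p∩q⁺ (x∈p , r⊆q x∈r) , x∈r)

Empty⇒∣p∣≡0 : ∀ {n} {p : Subset n} → Empty p → ∣ p ∣ ≡ 0
Empty⇒∣p∣≡0 {n} e = trans (cong ∣_∣ (Empty-unique e)) (∣⊥∣≡0 n)

x∈p⇒0<∣p∣ : ∀ {n} {p : Subset n} {x} → x ∈ p → 0 < ∣ p ∣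
x∈p⇒0<∣p∣ {p = p} {x} x∈p = subst (_≤ ∣ p ∣) (∣⁅x⁆∣≡1 x)
  (p⊆q⇒∣p∣≤∣q∣ (λ y∈⁅x⁆ → subst (_∈ p) (sym (x∈⁅y⁆⇒x≡y x y∈⁅x⁆)) x∈p))

∣p∣≤1 : ∀ {n} {p : Subset n} → (∀ {x y} → x ∈ p → y ∈ p → x ≡ y) → ∣ p ∣ ≤ 1
∣p∣≤1 {p = p} unique with nonempty? p
... | no empty = ≤-trans (≤-reflexive (Empty⇒∣p∣≡0 empty)) z≤n
... | yes (x , x∈p) = subst (∣ p ∣ ≤_) (∣⁅x⁆∣≡1 x)
  (p⊆q⇒∣p∣≤∣q∣ (λ y∈p → subst (_∈ ⁅ x ⁆) (unique x∈p y∈p) (x∈⁅x⁆ x)))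

minOver-nonempty : ∀ {n} (S : Subset n) f → Nonempty S → ∃[ x ] minOver S f ≡ just x
minOver-nonempty (inside ∷ S)  f _                 = _ , refl
minOver-nonempty (outside ∷ S) f (suc v , there v∈S) = minOver-nonempty S (f ∘ suc) (v , v∈S)

minOver-≤ : ∀ {n} (S : Subset n) f {x} → minOver S f ≡ just x → ∀ {v} → v ∈ S → x ≤ f v
minOver-≤ (inside ∷ S) f eq v∈S with minOver S (f ∘ suc) in eq′
minOver-≤ (inside ∷ S) f refl here | nothing = ≤-refl
minOver-≤ (inside ∷ S) f refl {suc v} (there v∈S) | nothing
  with () ← trans (sym (proj₂ (minOver-nonempty S (f ∘ suc) (v , v∈S)))) eq′
minOver-≤ (inside ∷ S) f refl here | just y = m⊓n≤m (f zero) y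
minOver-≤ (inside ∷ S) f refl (there v∈S) | just y = ≤-trans (m⊓n≤n (f zero) y) (minOver-≤ S (f ∘ suc) eq′ v∈S)
minOver-≤ (outside ∷ S) f eq (there v∈S) = minOver-≤ S (f ∘ suc) eq v∈S

minOver-glb : ∀ {n} (S : Subset n) f {k x} → (∀ v → k ≤ f v) → minOver S f ≡ just x → k ≤ x
minOver-glb (inside ∷ S) f k≤f eq with minOver S (f ∘ suc) in eq′
minOver-glb (inside ∷ S) f k≤f refl | nothing = k≤f zero
minOver-glb (inside ∷ S) f k≤f refl | just y = ⊓-glb (k≤f zero) (minOver-glb S (f ∘ suc) (k≤f ∘ suc) eq′)
minOver-glb (outside ∷ S) f k≤f eq = minOver-glb S (f ∘ suc) (k≤f ∘ suc) eq

maxAll-upper : ∀ {N} (f : Fin N → ℕ) j → f j ≤ maxAll f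
maxAll-upper f zero    = m≤m⊔n _ _
maxAll-upper f (suc j) = ≤-trans (maxAll-upper (f ∘ suc) j) (m≤n⊔m (f zero) _)

m≤ceilDiv[m,n]*n : ∀ m n → 0 < n → m ≤ ceilDiv m n * n
m≤ceilDiv[m,n]*n m (suc n) _ = +-cancelʳ-≤ n m _ (begin
  m + n                   ≡⟨ m≡m%n+[m/n]*n (m + n) (suc n) ⟩
  (m + n) % suc n + q     ≤⟨ +-monoˡ-≤ q (s≤s⁻¹ (m%n<n (m + n) (suc n))) ⟩
  n + q                   ≡⟨ +-comm n q ⟩
  q + n                   ∎)
  where
  open ≤-Reasoning
  q : ℕ
  q = (m + n) / suc n * suc n

m∸[1+n]<o⇒m≤n+o : ∀ m n {o} → m ∸ suc n < o → m ≤ n + o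
m∸[1+n]<o⇒m≤n+o m n {o} lt = begin
  m                   ≤⟨ m≤n+m∸n m (suc n) ⟩
  suc n + (m ∸ suc n) ≡⟨ +-suc n (m ∸ suc n) ⟨
  n + suc (m ∸ suc n) ≤⟨ +-monoʳ-≤ n lt ⟩
  n + o               ∎
  where open ≤-Reasoning

m∸n≡1+[m∸[1+n]] : ∀ {m n} → n < m → m ∸ n ≡ suc (m ∸ suc n)
m∸n≡1+[m∸[1+n]] {suc m} (s≤s n≤m) = +-∸-assoc 1 n≤m

module DescendingKernel {N ℓ} (_⟶_ : Fin N → Fin N → Set ℓ) (_⟶?_ : ∀ i j → Dec (i ⟶ j))
                        (descending : ∀ {i j} → i ⟶ j → toℕ j < toℕ i) where

  IsKernelOf : Subset N → Subset N → Set ℓ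
  IsKernelOf S U =
    U ⊆ S
    × (∀ i j → i ∈ U → j ∈ U → ¬ i ⟶ j)
    × (∀ i → i ∈ S → i ∉ U → ∃[ j ] (j ∈ U × i ⟶ j))

  kernel-nonempty : ∀ {S U} → IsKernelOf S U → Nonempty S → Nonempty U
  kernel-nonempty {U = U} (_ , _ , absorbing) (x , x∈S) with x ∈? U
  ... | yes x∈U = x , x∈U
  ... | no x∉U  = let (j , j∈U , _) = absorbing x x∈S x∉U in j , j∈U

  -- Either x is absorbed by U, or U ∪ {x} stays independent because nothing in S points to x.
  kernel-insert : ∀ {S U x} → x ∈ S → (∀ {i} → i ∈ S → ¬ i ⟶ x) →
                  IsKernelOf (S - x) U → ∃ (IsKernelOf S)
  kernel-insert {S} {U} {x} x∈S no-arc-to-x (U⊆S-x , independent , absorbing) =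
    extend (any? (λ j → (j ∈? U) ×-dec (x ⟶? j)))
    where
    U⊆S : U ⊆ S
    U⊆S = p─q⊆p S ⁅ x ⁆ ∘ U⊆S-x

    extend : Dec (∃[ j ] (j ∈ U × x ⟶ j)) → ∃ (IsKernelOf S)
    extend (yes (j , j∈U , x⟶j)) = U , U⊆S , independent , absorbing′
      where
      absorbing′ : ∀ i → i ∈ S → i ∉ U → ∃[ j ] (j ∈ U × i ⟶ j)
      absorbing′ i i∈S i∉U with i Fin.≟ x
      ... | yes refl = j , j∈U , x⟶j
      ... | no i≢x   = absorbing i (x∈p∧x≢y⇒x∈p-y i∈S i≢x) i∉U
    extend (no x-unabsorbed) = U ∪ ⁅ x ⁆ , U∪x⊆S , independent′ , absorbing′
      where
      cases : ∀ {i} → i ∈ U ∪ ⁅ x ⁆ → i ∈ U ⊎ i ≡ x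
      cases {i} i∈ with x∈p∪q⁻ U ⁅ x ⁆ i∈
      ... | inj₁ i∈U = inj₁ i∈U
      ... | inj₂ i∈x = inj₂ (x∈⁅y⁆⇒x≡y x i∈x)

      U∪x⊆S : U ∪ ⁅ x ⁆ ⊆ S
      U∪x⊆S i∈ with cases i∈
      ... | inj₁ i∈U  = U⊆S i∈U
      ... | inj₂ refl = x∈S

      independent′ : ∀ i j → i ∈ U ∪ ⁅ x ⁆ → j ∈ U ∪ ⁅ x ⁆ → ¬ i ⟶ j
      independent′ i j i∈ j∈ i⟶j with cases i∈ | cases j∈
      ... | inj₁ i∈U  | inj₁ j∈U  = independent i j i∈U j∈U i⟶j
      ... | inj₂ refl | inj₁ j∈U  = x-unabsorbed (j , j∈U , i⟶j)
      ... | _         | inj₂ refl = no-arc-to-x (U∪x⊆S i∈) i⟶j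

      absorbing′ : ∀ i → i ∈ S → i ∉ U ∪ ⁅ x ⁆ → ∃[ j ] (j ∈ U ∪ ⁅ x ⁆ × i ⟶ j)
      absorbing′ i i∈S i∉ with absorbing i (x∈p∧x≢y⇒x∈p-y i∈S i≢x) (i∉ ∘ x∈p∪q⁺ ∘ inj₁)
        where
        i≢x : i ≢ x
        i≢x refl = i∉ (x∈p∪q⁺ (inj₂ (x∈⁅x⁆ x)))
      ... | j , j∈U , i⟶j = j , x∈p∪q⁺ (inj₁ j∈U) , i⟶j

  kernel-below : ∀ b S → (∀ {i} → i ∈ S → toℕ i < b) → ∃ (IsKernelOf S)
  kernel-below zero    S bounded = ⊥ , ⊥⊆ , (λ i j i∈⊥ → contradiction i∈⊥ ∉⊥) ,
                                   (λ i i∈S → contradiction (bounded i∈S) n≮0)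
  kernel-below (suc b) S bounded with any? (λ x → (x ∈? S) ×-dec (toℕ x ≟ b))
  ... | no no-top = kernel-below b S (λ i∈S → ≤∧≢⇒< (s≤s⁻¹ (bounded i∈S)) (λ i≡b → no-top (_ , i∈S , i≡b)))
  ... | yes (x , x∈S , x≡b) = kernel-insert x∈S no-arc-to-x (proj₂ (kernel-below b (S - x) below-b))
    where
    no-arc-to-x : ∀ {i} → i ∈ S → ¬ i ⟶ x
    no-arc-to-x i∈S i⟶x = <⇒≱ (descending i⟶x) (subst (_ ≤_) (sym x≡b) (s≤s⁻¹ (bounded i∈S)))
    below-b : ∀ {i} → i ∈ S - x → toℕ i < b
    below-b {i} i∈ = ≤∧≢⇒< (s≤s⁻¹ (bounded (p─q⊆p S ⁅ x ⁆ i∈)))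
      (λ i≡b → x∈p─q⇒x∉q S ⁅ x ⁆ i∈ (subst (_∈ ⁅ x ⁆) (toℕ-injective (trans x≡b (sym i≡b))) (x∈⁅x⁆ x)))

  kernel : ∀ S → ∃ (IsKernelOf S)
  kernel S = kernel-below N S (λ {i} _ → toℕ<n i)

module Algorithm (I : Instance) where
  open Instance I

  arc? : ∀ i j → Dec (Arc I i j)
  arc? i j = (toℕ j <? toℕ i) ×-dec any? (λ v → (v ∈? edge i) ×-dec (v ∈? edge j))

  open DescendingKernel (Arc I) arc? proj₁ public using (kernel; kernel-nonempty)

  incident⁺ : ∀ {j v} → v ∈ edge j → j ∈ incident I v
  incident⁺ {v = v} = ∈-comprehension⁺ (λ i → v ∈? edge i)

  incident⁻ : ∀ {j v} → j ∈ incident I v → v ∈ edge j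
  incident⁻ {v = v} = ∈-comprehension⁻ (λ i → v ∈? edge i)

  released⁺ : ∀ {j t} → rel j < t → j ∈ released I t
  released⁺ {t = t} = ∈-comprehension⁺ (λ i → rel i <? t)

  released⁻ : ∀ {j t} → j ∈ released I t → rel j < t
  released⁻ {t = t} = ∈-comprehension⁻ (λ i → rel i <? t)

  outNbrs⁺ : ∀ {i j} → Arc I i j → j ∈ outNbrs I i
  outNbrs⁺ {i} = ∈-comprehension⁺ (arc? i)

  scheduleAt-∈ : ∀ {t U σ j} → j ∈ U → scheduleAt I t U σ j ≡ t ∷ σ j
  scheduleAt-∈ {t} {U} {σ} {j} j∈U = cong (if_then t ∷ σ j else σ j) (dec-true (j ∈? U) j∈U)

  scheduleAt-∉ : ∀ {t U σ j} → j ∉ U → scheduleAt I t U σ j ≡ σ j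
  scheduleAt-∉ {t} {U} {σ} {j} j∉U = cong (if_then t ∷ σ j else σ j) (dec-false (j ∈? U) j∉U)

  kernel-≤1-per-node : ∀ {S U} → IsKernel I S U → ∀ v → ∣ U ∩ incident I v ∣ ≤ 1
  kernel-≤1-per-node {U = U} (_ , independent , _) v = ∣p∣≤1 unique
    where
    unique : ∀ {j k} → j ∈ U ∩ incident I v → k ∈ U ∩ incident I v → j ≡ k
    unique {j} {k} j∈ k∈ with x∈p∩q⁻ U _ j∈ | x∈p∩q⁻ U _ k∈ | <-cmp (toℕ j) (toℕ k)
    ... | j∈U , j∋v | k∈U , k∋v | tri< j<k _ _ =
      contradiction (j<k , v , incident⁻ k∋v , incident⁻ j∋v) (independent k j k∈U j∈U)
    ... | _         | _         | tri≈ _ j≡k _ = toℕ-injective j≡k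
    ... | j∈U , j∋v | k∈U , k∋v | tri> _ _ k<j =
      contradiction (k<j , v , incident⁻ j∋v , incident⁻ k∋v) (independent j k j∈U k∈U)

  residual : (Fin n → ℕ) → Subset N → Fin n → ℕ
  residual c U v = c v ∸ ∣ U ∩ incident I v ∣

  StaysActive : (Fin n → ℕ) → Subset N → Subset N → Fin N → Set
  StaysActive c O′ U i = i ∈ O′ × i ∉ U × (∀ v → v ∈ edge i → ¬ (residual c U v ≡ 0))

  staysActive? : ∀ c O′ U i → Dec (StaysActive c O′ U i)
  staysActive? c O′ U i =
    (i ∈? O′) ×-dec ¬? (i ∈? U) ×-dec all? (λ v → (v ∈? edge i) →-dec ¬? (residual c U v ≟ 0))

  nextActive : (Fin n → ℕ) → Subset N → Subset N → Subset N
  nextActive c O′ U = tabulate (does ∘ staysActive? c O′ U)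

  ∣nextActive∣<∣O′∣ : ∀ {c O′ U} → IsKernel I O′ U → Nonempty O′ → ∣ nextActive c O′ U ∣ < ∣ O′ ∣
  ∣nextActive∣<∣O′∣ {c} {O′} {U} K@(U⊆O′ , _) O′≢∅ with kernel-nonempty K O′≢∅
  ... | j , j∈U = p⊂q⇒∣p∣<∣q∣
    ( proj₁ ∘ ∈-comprehension⁻ (staysActive? c O′ U)
    , j , U⊆O′ j∈U , λ j∈next → proj₁ (proj₂ (∈-comprehension⁻ (staysActive? c O′ U) j∈next)) j∈U)

  Inner-exists : ∀ b t R O′ c σ → ∣ O′ ∣ ≤ b → ∃[ R* ] ∃[ σ* ] Inner I t R O′ c σ R* σ*
  Inner-exists b t R O′ c σ ∣O′∣≤b with nonempty? O′
  ... | no O′≡∅ = R , σ , done O′≡∅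
  Inner-exists zero t R O′ c σ ∣O′∣≤0 | yes (_ , x∈O′) = contradiction (≤-trans (x∈p⇒0<∣p∣ x∈O′) ∣O′∣≤0) λ ()
  Inner-exists (suc b) t R O′ c σ ∣O′∣≤1+b | yes O′≢∅ with kernel O′
  ... | U , K with Inner-exists b t (R ─ U) (nextActive c O′ U) (residual c U) (scheduleAt I t U σ)
                     (s≤s⁻¹ (<-≤-trans (∣nextActive∣<∣O′∣ K O′≢∅) ∣O′∣≤1+b))
  ... | R* , σ* , run = R* , σ* , step U (nextActive c O′ U) O′≢∅ K
          (λ i → ∈-comprehension⁻ (staysActive? c O′ U))
          (λ i i∈O′ i∉U unsaturated → ∈-comprehension⁺ (staysActive? c O′ U) (i∈O′ , i∉U , unsaturated))
          run

  Slots-exists : ∀ k t R σ → ∃[ σ* ] Slots I t k R σ σ*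
  Slots-exists zero    t R σ = σ , stop
  Slots-exists (suc k) t R σ with Inner-exists _ t R (R ∩ released I t) cap σ ≤-refl
  ... | R′ , σ′ , run with Slots-exists k (suc t) R′ σ′
  ... | σ* , rest = σ* , next run rest

  scheduledAt? : (σ : Schedule N) (s : ℕ) (v : Fin n) → ∀ i → Dec (v ∈ edge i × s ∈ₗ σ i)
  scheduledAt? σ s v i = (v ∈? edge i) ×-dec (s ∈ₗ? σ i)

  load≤∣A∣ : ∀ σ s v {A} → (∀ {i} → v ∈ edge i → s ∈ₗ σ i → i ∈ A) → load I σ s v ≤ ∣ A ∣
  load≤∣A∣ σ s v into-A = p⊆q⇒∣p∣≤∣q∣ λ i∈ →
    let (v∈i , s∈σi) = ∈-comprehension⁻ (scheduledAt? σ s v) i∈ in into-A v∈i s∈σi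

  load-mono : ∀ σ σ′ s v → (∀ {i} → v ∈ edge i → s ∈ₗ σ′ i → s ∈ₗ σ i) → load I σ′ s v ≤ load I σ s v
  load-mono σ σ′ s v old = load≤∣A∣ σ′ s v λ v∈i s∈σ′i →
    ∈-comprehension⁺ (scheduledAt? σ s v) (v∈i , old v∈i s∈σ′i)

  record LoopInvariant (t : ℕ) (R O′ : Subset N) (c : Fin n → ℕ) : Set where
    field
      active⊆remaining   : O′ ⊆ R
      active-released    : ∀ {j} → j ∈ O′ → rel j < t
      active-unsaturated : ∀ {j v} → j ∈ O′ → v ∈ edge j → ¬ (c v ≡ 0)
  open LoopInvariant

  LoopInvariant-step : ∀ {t R O′ c U O″} → LoopInvariant t R O′ c →
                       (∀ i → i ∈ O″ → StaysActive c O′ U i) → LoopInvariant t (R ─ U) O″ (residual c U)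
  LoopInvariant-step inv stays = record
    { active⊆remaining   = λ i∈O″ → let (i∈O′ , i∉U , _) = stays _ i∈O″ in
                                    x∈p∧x∉q⇒x∈p─q (active⊆remaining inv i∈O′) i∉U
    ; active-released    = λ i∈O″ → active-released inv (proj₁ (stays _ i∈O″))
    ; active-unsaturated = λ i∈O″ → proj₂ (proj₂ (stays _ i∈O″)) _
    }

  kernel-within-capacity : ∀ {t R O′ c U} → LoopInvariant t R O′ c → IsKernel I O′ U →
                           ∀ v → ∣ U ∩ incident I v ∣ ≤ c v
  kernel-within-capacity {c = c} {U} inv K v with c v in cv≡
  ... | suc _ = ≤-trans (kernel-≤1-per-node K v) (s≤s z≤n)
  ... | zero  = ≤-reflexive (Empty⇒∣p∣≡0 λ (j , j∈) → let (j∈U , j∋v) = x∈p∩q⁻ U _ j∈ in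
                  active-unsaturated inv (proj₁ K j∈U) (incident⁻ j∋v) cv≡)

  Inner-⊆ : ∀ {t R O′ c σ R* σ*} → Inner I t R O′ c σ R* σ* → R* ⊆ R
  Inner-⊆ (done _)                    j∈R* = j∈R*
  Inner-⊆ {R = R} (step U _ _ _ _ _ run) j∈R* = p─q⊆p R U (Inner-⊆ run j∈R*)

  Inner-keeps : ∀ {t R O′ c σ R* σ*} → LoopInvariant t R O′ c → Inner I t R O′ c σ R* σ* →
                ∀ {j} → (j ∈ R → j ∈ R*) → σ* j ≡ σ j
  Inner-keeps inv (done _) kept = refl
  Inner-keeps {R = R} {σ = σ} inv (step U _ _ K stays _ run) {j} kept =
    trans (Inner-keeps (LoopInvariant-step inv stays) run (kept ∘ p─q⊆p R U)) (scheduleAt-∉ {σ = σ} j∉U)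
    where
    j∉U : j ∉ U
    j∉U j∈U = x∈p─q⇒x∉q R U (Inner-⊆ run (kept (active⊆remaining inv (proj₁ K j∈U)))) j∈U

  Inner-schedules : ∀ {t R O′ c σ R* σ*} → LoopInvariant t R O′ c → Inner I t R O′ c σ R* σ* →
                    ∀ {j} → j ∈ R → j ∉ R* → σ* j ≡ t ∷ σ j × rel j < t
  Inner-schedules inv (done _) j∈R j∉R = contradiction j∈R j∉R
  Inner-schedules {t} {R} {c = c} {σ} {σ* = σ*} inv (step U O″ _ K stays _ run) {j} j∈R j∉R* = by-cases (j ∈? U)
    where
    inv′ : LoopInvariant t (R ─ U) O″ (residual c U)
    inv′ = LoopInvariant-step inv stays
    by-cases : Dec (j ∈ U) → σ* j ≡ t ∷ σ j × rel j < t
    by-cases (yes j∈U) =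
      trans (Inner-keeps inv′ run (λ j∈R─U → contradiction j∈U (x∈p─q⇒x∉q R U j∈R─U)))
            (scheduleAt-∈ {σ = σ} j∈U)
      , active-released inv (proj₁ K j∈U)
    by-cases (no j∉U) =
      let (σ*j≡ , released) = Inner-schedules inv′ run (x∈p∧x∉q⇒x∈p─q j∈R j∉U) j∉R*
      in trans σ*j≡ (cong (t ∷_) (scheduleAt-∉ {σ = σ} j∉U)) , released

  Inner-within-capacity : ∀ {t R O′ c σ R* σ*} → LoopInvariant t R O′ c → Inner I t R O′ c σ R* σ* →
                          ∀ v → ∣ (R ─ R*) ∩ incident I v ∣ ≤ c v
  Inner-within-capacity {R = R} inv (done _) v = ≤-trans (≤-reflexive (Empty⇒∣p∣≡0 λ (j , j∈) →
    let j∈R─R = p∩q⊆p (R ─ R) _ j∈ in x∈p─q⇒x∉q R R j∈R─R (p─q⊆p R R j∈R─R))) z≤n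
  Inner-within-capacity {t} {R} {c = c} {R* = R*} inv (step U O″ _ K stays _ run) v = begin
    ∣ (R ─ R*) ∩ incident I v ∣                 ≤⟨ p─r⊆q⇒∣p∣≤∣q∣+∣r∣ (U ∩ incident I v) later ⟩
    ∣ (R ─ U ─ R*) ∩ incident I v ∣ + used      ≤⟨ +-monoˡ-≤ used (Inner-within-capacity inv′ run v) ⟩
    (c v ∸ used) + used                         ≡⟨ m∸n+n≡m (kernel-within-capacity inv K v) ⟩
    c v                                         ∎
    where
    open ≤-Reasoning
    inv′ : LoopInvariant t (R ─ U) O″ (residual c U)
    inv′ = LoopInvariant-step inv stays
    used : ℕ
    used = ∣ U ∩ incident I v ∣
    later : (R ─ R*) ∩ incident I v ─ U ∩ incident I v ⊆ (R ─ U ─ R*) ∩ incident I v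
    later {j} j∈ with x∈p∩q⁻ (R ─ R*) _ (p─q⊆p _ _ j∈)
    ... | j∈R─R* , j∋v =
      x∈p∩q⁺ (x∈p∧x∉q⇒x∈p─q (x∈p∧x∉q⇒x∈p─q (p─q⊆p R R* j∈R─R*) j∉U) (x∈p─q⇒x∉q R R* j∈R─R*) , j∋v)
      where
      j∉U : j ∉ U
      j∉U j∈U = x∈p─q⇒x∉q _ _ j∈ (x∈p∩q⁺ (j∈U , j∋v))

  -- Every round that leaves i active removes an out-neighbour of i (the kernel absorbs i) while
  -- lowering each c v by at most one; i leaves the active set only when some c v reaches 0.
  Inner-blocked : ∀ {t R O′ c σ R* σ*} → LoopInvariant t R O′ c → Inner I t R O′ c σ R* σ* →
                  ∀ {i} → i ∈ O′ → i ∈ R* →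
                  ∃[ v ] (v ∈ edge i × ∣ outNbrs I i ∩ R* ∣ + c v ≤ ∣ outNbrs I i ∩ R ∣)
  Inner-blocked inv (done O′≡∅) i∈O′ _ = contradiction (_ , i∈O′) O′≡∅
  Inner-blocked {R = R} {O′} {c} {R* = R*} inv (step U O″ _ K stays complete run) {i} i∈O′ i∈R* =
    finish (lost-later (i ∈? O″))
    where
    out : Subset N
    out = outNbrs I i

    i∉U : i ∉ U
    i∉U = x∈p─q⇒x∉q R U (Inner-⊆ run i∈R*)

    0<∣out∩U∣ : 0 < ∣ out ∩ U ∣
    0<∣out∩U∣ = let (j , j∈U , i⟶j) = proj₂ (proj₂ K) i i∈O′ i∉U in x∈p⇒0<∣p∣ (x∈p∩q⁺ (outNbrs⁺ i⟶j , j∈U))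

    lost-later : Dec (i ∈ O″) → ∃[ v ] (v ∈ edge i × ∣ out ∩ R* ∣ + residual c U v ≤ ∣ out ∩ (R ─ U) ∣)
    lost-later (yes i∈O″) = Inner-blocked (LoopInvariant-step inv stays) run i∈O″ i∈R*
    lost-later (no i∉O″) with any? (λ v → (v ∈? edge i) ×-dec (residual c U v ≟ 0))
    ... | no none = contradiction (complete i i∈O′ i∉U (λ v v∈i saturated → none (v , v∈i , saturated))) i∉O″
    ... | yes (v , v∈i , saturated) = v , v∈i , (begin
      ∣ out ∩ R* ∣ + residual c U v ≡⟨ cong (∣ out ∩ R* ∣ +_) saturated ⟩
      ∣ out ∩ R* ∣ + 0             ≡⟨ +-identityʳ _ ⟩
      ∣ out ∩ R* ∣                 ≤⟨ p⊆q⇒∣p∣≤∣q∣ out∩R*⊆out∩R─U ⟩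
      ∣ out ∩ (R ─ U) ∣            ∎)
      where
      open ≤-Reasoning
      out∩R*⊆out∩R─U : out ∩ R* ⊆ out ∩ (R ─ U)
      out∩R*⊆out∩R─U j∈ = let (j∈out , j∈R*) = x∈p∩q⁻ out R* j∈ in x∈p∩q⁺ (j∈out , Inner-⊆ run j∈R*)

    finish : ∃[ v ] (v ∈ edge i × ∣ out ∩ R* ∣ + residual c U v ≤ ∣ out ∩ (R ─ U) ∣) →
             ∃[ v ] (v ∈ edge i × ∣ out ∩ R* ∣ + c v ≤ ∣ out ∩ R ∣)
    finish (v , v∈i , lost) = v , v∈i , (begin
      ∣ out ∩ R* ∣ + c v                     ≤⟨ +-monoʳ-≤ ∣ out ∩ R* ∣ (m≤n+m∸n (c v) used) ⟩
      ∣ out ∩ R* ∣ + (used + residual c U v) ≡⟨ cong (∣ out ∩ R* ∣ +_) (+-comm used (residual c U v)) ⟩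
      ∣ out ∩ R* ∣ + (residual c U v + used) ≡⟨ +-assoc ∣ out ∩ R* ∣ (residual c U v) used ⟨
      ∣ out ∩ R* ∣ + residual c U v + used   ≤⟨ +-mono-≤ lost (≤-trans (kernel-≤1-per-node K v) 0<∣out∩U∣) ⟩
      ∣ out ∩ (R ─ U) ∣ + ∣ out ∩ U ∣        ≤⟨ ∣p∩[q─r]∣+∣p∩r∣≤∣p∩q∣ out R U (active⊆remaining inv ∘ proj₁ K) ⟩
      ∣ out ∩ R ∣                            ∎)
      where
      open ≤-Reasoning
      used : ℕ
      used = ∣ U ∩ incident I v ∣

module Analysis (I : Instance) (H : Hyps I) where
  open Instance I
  open Algorithm I

  cap-pos : ∀ v → 0 < cap v
  cap-pos = proj₁ H

  edge-nonempty : ∀ j → Nonempty (edge j)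
  edge-nonempty = proj₁ (proj₂ H)

  ∣edge∣≤λ : ∀ j → ∣ edge j ∣ ≤ lam
  ∣edge∣≤λ = proj₁ (proj₂ (proj₂ H))

  ∣outNbrs∣-bound : ∀ j → ∣ edge j ∣ * ∣ outNbrs I j ∣ + lam * ∣ edge j ∣ ≤ lam * (dl j * sumCap I j)
  ∣outNbrs∣-bound = proj₂ (proj₂ (proj₂ (proj₂ H)))

  minCap-pos : ∀ j → 0 < minCap I j
  minCap-pos j with minOver-nonempty (edge j) cap (edge-nonempty j)
  ... | x , eq rewrite eq = minOver-glb (edge j) cap cap-pos eq

  minCap-≤ : ∀ {j v} → v ∈ edge j → minCap I j ≤ cap v
  minCap-≤ {j} v∈j with minOver-nonempty (edge j) cap (edge-nonempty j)
  ... | x , eq rewrite eq = minOver-≤ (edge j) cap eq v∈j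

  latest : Fin N → ℕ
  latest j = rel j + lam * dl j * Δ I j

  latest≤horizon : ∀ j → latest j ≤ horizon I
  latest≤horizon j = +-mono-≤ (maxAll-upper rel j)
    (≤-trans (≤-reflexive (*-assoc lam (dl j) (Δ I j))) (*-monoʳ-≤ lam (maxAll-upper (λ i → dl i * Δ I i) j)))

  -- With d = |e| · min u, the hypothesis reads |e| |d⁺(e)| < λ D_e Σ u, and Σ u ≤ Δ(e) d; so k d < λ D_e Δ(e) d.
  waiting<λDΔ : ∀ j k → minCap I j * k ≤ ∣ outNbrs I j ∣ → k < lam * dl j * Δ I j
  waiting<λDΔ j k mk≤out = *-cancelʳ-< d k (lam * dl j * Δ I j) (begin-strict
    k * d                      ≡⟨ solve 3 (λ k E m → k :* (E :* m) := E :* (m :* k)) refl k E m ⟩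
    E * (m * k)                ≤⟨ *-monoʳ-≤ E mk≤out ⟩
    E * out                    <⟨ m<m+n (E * out) (*-mono-≤ (≤-trans 0<E (∣edge∣≤λ j)) 0<E) ⟩
    E * out + lam * E          ≤⟨ ∣outNbrs∣-bound j ⟩
    lam * (dl j * sumCap I j)  ≤⟨ *-monoʳ-≤ lam (*-monoʳ-≤ (dl j) sumCap≤Δd) ⟩
    lam * (dl j * (Δ I j * d)) ≡⟨ *-assoc lam (dl j) (Δ I j * d) ⟨
    lam * dl j * (Δ I j * d)   ≡⟨ *-assoc (lam * dl j) (Δ I j) d ⟨
    lam * dl j * Δ I j * d     ∎)
    where
    open ≤-Reasoning
    E m out d : ℕ
    E = ∣ edge j ∣
    m = minCap I j
    out = ∣ outNbrs I j ∣
    d = E * m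
    0<E : 0 < E
    0<E = x∈p⇒0<∣p∣ (proj₂ (edge-nonempty j))
    sumCap≤Δd : sumCap I j ≤ Δ I j * d
    sumCap≤Δd = m≤ceilDiv[m,n]*n (sumCap I j) d (*-mono-≤ 0<E (minCap-pos j))

  slot≤latest : ∀ j t → minCap I j * (t ∸ suc (rel j)) ≤ ∣ outNbrs I j ∣ → t ≤ latest j
  slot≤latest j t waited = m∸[1+n]<o⇒m≤n+o t (rel j) (waiting<λDΔ j _ waited)

  record SlotInvariant (t : ℕ) (R : Subset N) (σ : Schedule N) : Set where
    field
      pending-unscheduled : ∀ {j} → j ∈ R → σ j ≡ []
      done-scheduled      : ∀ {j} → j ∉ R → ∃[ s ] (σ j ≡ s ∷ [] × rel j < s × s ≤ latest j)
      slots-past          : ∀ {j s} → s ∈ₗ σ j → s < t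
      -- each released slot before t in which j stayed pending cost j at least minCap j out-neighbours
      progress            : ∀ {j} → j ∈ R →
                            minCap I j * (t ∸ suc (rel j)) + ∣ outNbrs I j ∩ R ∣ ≤ ∣ outNbrs I j ∣
      within-capacity     : ∀ s v → load I σ s v ≤ cap v
  open SlotInvariant

  SlotInvariant-initial : SlotInvariant 1 ⊤ (λ _ → [])
  SlotInvariant-initial = record
    { pending-unscheduled = λ _ → refl
    ; done-scheduled      = λ j∉⊤ → contradiction ∈⊤ j∉⊤
    ; slots-past          = λ ()
    ; progress            = λ {j} _ → subst (λ w → w + ∣ outNbrs I j ∩ ⊤ ∣ ≤ ∣ outNbrs I j ∣)
                              (sym (trans (cong (minCap I j *_) (0∸n≡0 (rel j))) (*-zeroʳ (minCap I j))))
                              (∣p∩q∣≤∣p∣ (outNbrs I j) ⊤)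
    ; within-capacity     = λ s v → ≤-trans (load≤∣A∣ (λ _ → []) s v {⊥} λ _ ())
                              (subst (_≤ cap v) (sym (∣⊥∣≡0 N)) z≤n)
    }

  SlotInvariant-step : ∀ {t R σ R′ σ′} → SlotInvariant t R σ → Inner I t R (R ∩ released I t) cap σ R′ σ′ →
                       SlotInvariant (suc t) R′ σ′
  SlotInvariant-step {t} {R} {σ} {R′} {σ′} inv run = record
    { pending-unscheduled = λ j∈R′ → trans (unchanged (λ _ → j∈R′)) (pending-unscheduled inv (Inner-⊆ run j∈R′))
    ; done-scheduled      = done′
    ; slots-past          = past′
    ; progress            = progress′
    ; within-capacity     = capacity′
    }
    where
    loop : LoopInvariant t R (R ∩ released I t) cap
    loop = record
      { active⊆remaining   = p∩q⊆p R (released I t)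
      ; active-released    = released⁻ ∘ p∩q⊆q R (released I t)
      ; active-unsaturated = λ {_} {v} _ _ → >⇒≢ (cap-pos v)
      }

    unchanged : ∀ {j} → (j ∈ R → j ∈ R′) → σ′ j ≡ σ j
    unchanged = Inner-keeps loop run

    new-entries : ∀ {j s} → s ∈ₗ σ′ j → (s ≡ t × j ∈ R ─ R′) ⊎ s ∈ₗ σ j
    new-entries {j} {s} s∈ with j ∈? R | j ∈? R′
    ... | yes j∈R | no j∉R′ = map₁ (_, x∈p∧x∉q⇒x∈p─q j∈R j∉R′)
                                (toSum (subst (s ∈ₗ_) (proj₁ (Inner-schedules loop run j∈R j∉R′)) s∈))
    ... | _       | yes j∈R′ = inj₂ (subst (s ∈ₗ_) (unchanged (λ _ → j∈R′)) s∈)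
    ... | no j∉R  | _        = inj₂ (subst (s ∈ₗ_) (unchanged (λ j∈R → contradiction j∈R j∉R)) s∈)

    done′ : ∀ {j} → j ∉ R′ → ∃[ s ] (σ′ j ≡ s ∷ [] × rel j < s × s ≤ latest j)
    done′ {j} j∉R′ with j ∈? R
    ... | yes j∈R = let (σ′j≡ , r<t) = Inner-schedules loop run j∈R j∉R′ in
      t , trans σ′j≡ (cong (t ∷_) (pending-unscheduled inv j∈R)) , r<t ,
      slot≤latest j t (≤-trans (m≤m+n _ _) (progress inv j∈R))
    ... | no j∉R = let (s , σj≡ , r<s , s≤) = done-scheduled inv j∉R in
      s , trans (unchanged (λ j∈R → contradiction j∈R j∉R)) σj≡ , r<s , s≤

    past′ : ∀ {j s} → s ∈ₗ σ′ j → s < suc t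
    past′ s∈ with new-entries s∈
    ... | inj₁ (refl , _) = n<1+n t
    ... | inj₂ s∈σj       = m<n⇒m<1+n (slots-past inv s∈σj)

    progress′ : ∀ {j} → j ∈ R′ → minCap I j * (t ∸ rel j) + ∣ outNbrs I j ∩ R′ ∣ ≤ ∣ outNbrs I j ∣
    progress′ {j} j∈R′ with rel j <? t
    ... | no t≤r = subst (λ w → w + ∣ outNbrs I j ∩ R′ ∣ ≤ ∣ outNbrs I j ∣)
                     (sym (trans (cong (minCap I j *_) (m≤n⇒m∸n≡0 (≮⇒≥ t≤r))) (*-zeroʳ (minCap I j))))
                     (∣p∩q∣≤∣p∣ (outNbrs I j) R′)
    ... | yes r<t with Inner-blocked loop run (x∈p∩q⁺ (Inner-⊆ run j∈R′ , released⁺ r<t)) j∈R′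
    ... | v , v∈j , lost = begin
      m * (t ∸ rel j) + X        ≡⟨ cong (λ w → m * w + X) (m∸n≡1+[m∸[1+n]] r<t) ⟩
      m * suc w + X              ≡⟨ solve 3 (λ m w X → m :* (con 1 :+ w) :+ X := m :* w :+ (X :+ m)) refl m w X ⟩
      m * w + (X + m)            ≤⟨ +-monoʳ-≤ (m * w) (+-monoʳ-≤ X (minCap-≤ v∈j)) ⟩
      m * w + (X + cap v)        ≤⟨ +-monoʳ-≤ (m * w) lost ⟩
      m * w + ∣ outNbrs I j ∩ R ∣ ≤⟨ progress inv (Inner-⊆ run j∈R′) ⟩
      ∣ outNbrs I j ∣             ∎
      where
      open ≤-Reasoning
      m w X : ℕ
      m = minCap I j
      w = t ∸ suc (rel j)
      X = ∣ outNbrs I j ∩ R′ ∣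

    capacity′ : ∀ s v → load I σ′ s v ≤ cap v
    capacity′ s v with s ≟ t
    ... | yes refl = ≤-trans (load≤∣A∣ σ′ s v removed) (Inner-within-capacity loop run v)
      where
      removed : ∀ {i} → v ∈ edge i → s ∈ₗ σ′ i → i ∈ (R ─ R′) ∩ incident I v
      removed v∈i s∈ with new-entries s∈
      ... | inj₁ (_ , i∈R─R′) = x∈p∩q⁺ (i∈R─R′ , incident⁺ v∈i)
      ... | inj₂ s∈σi         = contradiction (slots-past inv s∈σi) (n≮n s)
    ... | no s≢t = ≤-trans (load-mono σ σ′ s v old) (within-capacity inv s v)
      where
      old : ∀ {i} → v ∈ edge i → s ∈ₗ σ′ i → s ∈ₗ σ i
      old _ s∈ with new-entries s∈
      ... | inj₁ (s≡t , _) = contradiction s≡t s≢t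
      ... | inj₂ s∈σi      = s∈σi

  Slots-invariant : ∀ {t k R σ σ*} → Slots I t k R σ σ* → SlotInvariant t R σ →
                    ∃[ R* ] SlotInvariant (k + t) R* σ*
  Slots-invariant stop inv = _ , inv
  Slots-invariant {t} {suc k} {σ* = σ*} (next run rest) inv
    with Slots-invariant rest (SlotInvariant-step inv run)
  ... | R* , inv* = R* , subst (λ u → SlotInvariant u R* σ*) (+-suc k t) inv*

  SlotInvariant-final : ∀ {t R σ} → SlotInvariant t R σ → horizon I < t → Feasible I σ × WithinBound I σ
  SlotInvariant-final {t} {R} {σ} inv horizon<t = ((λ j → let (s , σj≡ , r<s , _) = finished j in s , σj≡ , r<s)
                                                   , within-capacity inv)
                                                  , λ j → let (s , σj≡ , _ , s≤) = finished j in s , σj≡ , s≤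
    where
    finished : ∀ j → ∃[ s ] (σ j ≡ s ∷ [] × rel j < s × s ≤ latest j)
    finished j = done-scheduled inv λ j∈R →
      <⇒≱ horizon<t (≤-trans (slot≤latest j t (≤-trans (m≤m+n _ _) (progress inv j∈R))) (latest≤horizon j))

lemma6 : (I : Instance) → Hyps I →
    (∃[ σ ] AlgOutput I σ)
    × (∀ σ → AlgOutput I σ → Feasible I σ × WithinBound I σ)
lemma6 I H = Slots-exists (horizon I) 1 ⊤ (λ _ → []) , λ σ run →
  let (_ , final) = Slots-invariant run SlotInvariant-initial
  in SlotInvariant-final final (m<m+n (horizon I) z<s)
  where
  open Algorithm I
  open Analysis I H
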